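{- Let $i\ge 0$ be an integer, let $j,n\in\mathbb{N}$, and let $q$ be an odd prime such that $q-1\nmid n$ and $q^i\mid n$. Then $S_n(q^j)\equiv 0\pmod{q^{i+j}}$, where $S_n(m)=\sum_{r=1}^m r^n$.
   Context: $\mathbb{N}$ denotes the positive integers. $S_n(m)=1^n+2^n+\dots+m^n$. -}

module Defs where

open import Data.Nat using (ℕ; zero; suc; _+_; _^_)

S : ℕ → ℕ → ℕ
S n zero = 0
S n (suc m) = S n m + suc m ^ n

-- Write p = q − 1, N = q^j, K = i + j and T = Σ_{r<N} r^n, so that
-- S_n(N) = T + N^n and q^K ∣ N^n.  Since p ∤ n there is a residue 1 ≤ c ≤ p
-- with c^n ≢ 1 (mod q); otherwise S_n(p) ≡ p (mod q), while the classical
-- power-sum recursion together with Fermat's little theorem shows q ∣ S_n(p).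
-- As c is a unit modulo N, r ↦ c·r (mod N) permutes the residues modulo N, and
-- since q^i ∣ n, the power r^n modulo q^K only depends on r modulo N (a
-- congruence modulo q^(k+1) lifts to q-th powers modulo q^(k+2)).  Hence
-- c^n·T ≡ T (mod q^K), and as c^n − 1 is prime to q, q^K ∣ T.

module Submission where

open import Defs
open import Data.Nat using (ℕ; _+_; _∸_; _^_; _≥_)
open import Data.Nat.Divisibility using (_∣_)
open import Data.Nat.Primality using (Prime)
open import Relation.Nullary using (¬_)

open import Data.Nat
open import Data.Nat.Properties
open import Data.Nat.Divisibility
open import Data.Nat.Tactic.RingSolver using (solve-∀)
open import Data.Nat.Induction using (<-rec)
open import Data.Nat.Combinatorics using (_C_; nCn≡1; nC1≡n; nCk≡nC[n∸k]; nCk+nC[k+1]≡[n+1]C[k+1])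
open import Data.Bool.Base using (T; true; false)
open import Data.Unit.Base using (tt)
open import Data.Fin.Base using (Fin; toℕ; fromℕ<)
open import Data.Fin.Properties using (toℕ-fromℕ<; toℕ-injective; toℕ<n; ¬∀⟶∃¬)
open import Data.Fin.Permutation using (Permutation; permutation)
open import Relation.Binary.PropositionalEquality
open import Relation.Nullary using (contradiction; Dec; yes; no)
open import Relation.Nullary.Decidable using (map′)
open import Relation.Binary.Structures using (IsEquivalence)
open import Relation.Binary.Bundles using (Setoid)
import Relation.Binary.Reasoning.Setoid as SetoidReasoning
open import Level using (0ℓ)
import Data.Nat.Coprimality as Coprime
open import Data.Nat.Coprimality using (Coprime; coprime-divisor; coprime-Bézout)
open import Data.Nat.GCD using (module Bézout)
open import Data.Nat.Primality using (prime⇒irreducible; prime⇒nonTrivial; prime⇒nonZero; euclidsLemma)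
open import Data.Product using (_,_; ∃-syntax; _×_)
open import Data.Sum using (inj₁; inj₂; [_,_]′)
open import Data.Nat.DivMod using (_%_; _/_; m≡m%n+[m/n]*n; [m+kn]%n≡m%n; m<n⇒m%n≡m; m%n<n)

import Algebra.Properties.CommutativeSemiring.Binomial +-*-commutativeSemiring as Binomial
import Algebra.Properties.Semiring.Exp +-*-semiring as SemiringExp
import Algebra.Properties.Monoid.Mult +-0-monoid as MonoidMult
import Algebra.Properties.CommutativeSemiring.Exp +-*-commutativeSemiring as CommutativeExp
open import Algebra.Properties.CommutativeMonoid.Sum +-0-commutativeMonoid
  using (sum; sum-cong-≗; sum-permute)

Σ< : ℕ → (ℕ → ℕ) → ℕ
Σ< zero    f = 0
Σ< (suc n) f = Σ< n f + f n

Σ<-cong : ∀ n {f g : ℕ → ℕ} → (∀ k → k < n → f k ≡ g k) → Σ< n f ≡ Σ< n g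
Σ<-cong zero    eq = refl
Σ<-cong (suc n) eq = cong₂ _+_ (Σ<-cong n (λ k k<n → eq k (m<n⇒m<1+n k<n))) (eq n ≤-refl)

Σ<-+ : ∀ n (f g : ℕ → ℕ) → Σ< n (λ k → f k + g k) ≡ Σ< n f + Σ< n g
Σ<-+ zero    f g = refl
Σ<-+ (suc n) f g rewrite Σ<-+ n f g = interchange (Σ< n f) (Σ< n g) (f n) (g n)
  where
  interchange : ∀ a b c d → a + b + (c + d) ≡ a + c + (b + d)
  interchange = solve-∀

Σ<-*ˡ : ∀ n a (f : ℕ → ℕ) → Σ< n (λ k → a * f k) ≡ a * Σ< n f
Σ<-*ˡ zero    a f = sym (*-zeroʳ a)
Σ<-*ˡ (suc n) a f rewrite Σ<-*ˡ n a f = sym (*-distribˡ-+ a (Σ< n f) (f n))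

Σ<-head : ∀ n (f : ℕ → ℕ) → Σ< (suc n) f ≡ f 0 + Σ< n (λ k → f (suc k))
Σ<-head zero    f = sym (+-identityʳ (f 0))
Σ<-head (suc n) f rewrite Σ<-head n f = +-assoc (f 0) _ _

Σ<-∣ : ∀ {d} n (f : ℕ → ℕ) → (∀ k → k < n → d ∣ f k) → d ∣ Σ< n f
Σ<-∣ zero    f d∣f = _ ∣0
Σ<-∣ (suc n) f d∣f = ∣m∣n⇒∣m+n (Σ<-∣ n f (λ k k<n → d∣f k (m<n⇒m<1+n k<n))) (d∣f n ≤-refl)

sum≡Σ< : ∀ n (f : ℕ → ℕ) → sum {n} (λ r → f (toℕ r)) ≡ Σ< n f
sum≡Σ< zero    f = refl
sum≡Σ< (suc n) f = trans (cong (f 0 +_) (sum≡Σ< n (λ r → f (suc r)))) (sym (Σ<-head n f))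

S≡Σ< : ∀ n m → S n m ≡ Σ< m (λ r → suc r ^ n)
S≡Σ< n zero    = refl
S≡Σ< n (suc m) = cong (_+ suc m ^ n) (S≡Σ< n m)

S≡Σ<+last : ∀ n N → S (suc n) N ≡ Σ< N (λ r → r ^ suc n) + N ^ suc n
S≡Σ<+last n N = trans (S≡Σ< (suc n) N) (sym (Σ<-head N (λ r → r ^ suc n)))

S₀ : ∀ N → S 0 N ≡ N
S₀ zero    = refl
S₀ (suc N) = trans (cong (_+ 1) (S₀ N)) (+-comm N 1)

nCk≡0 : ∀ {n k} → n < k → n C k ≡ 0
nCk≡0 {n} {k} n<k with k ≤ᵇ n in k≤ᵇn
... | false = refl
... | true  = contradiction (≤ᵇ⇒≤ k n (subst T (sym k≤ᵇn) tt)) (<⇒≱ n<k)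

absorption : ∀ n k → suc k * (suc n C suc k) ≡ suc n * (n C k)
absorption zero    zero    = refl
absorption zero    (suc k) rewrite nCk≡0 {1} {suc (suc k)} (s≤s (s≤s z≤n)) = *-zeroʳ (suc (suc k))
absorption (suc n) zero    =
  trans (*-identityˡ (suc (suc n) C 1)) (trans (nC1≡n (suc (suc n))) (sym (*-identityʳ (suc (suc n)))))
absorption (suc n) (suc k) = begin
  suc (suc k) * (suc (suc n) C suc (suc k))
    ≡⟨ cong (suc (suc k) *_) (sym (pascal (suc n) (suc k))) ⟩
  suc (suc k) * (c + suc n C suc (suc k))
    ≡⟨ distribute (suc k) c (suc n C suc (suc k)) ⟩
  suc k * c + c + suc (suc k) * (suc n C suc (suc k))
    ≡⟨ cong₂ (λ a b → a + c + b) (absorption n k) (absorption n (suc k)) ⟩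
  suc n * (n C k) + c + suc n * (n C suc k)
    ≡⟨ collect (suc n) (n C k) (n C suc k) c ⟩
  suc n * (n C k + n C suc k) + c
    ≡⟨ cong (λ x → suc n * x + c) (pascal n k) ⟩
  suc n * c + c
    ≡⟨ +-comm (suc n * c) c ⟩
  suc (suc n) * c ∎
  where
  open ≡-Reasoning
  pascal : ∀ n k → n C k + n C suc k ≡ suc n C suc k
  pascal = nCk+nC[k+1]≡[n+1]C[k+1]
  c : ℕ
  c = suc n C suc k
  distribute : ∀ a x y → suc a * (x + y) ≡ a * x + x + suc a * y
  distribute = solve-∀
  collect : ∀ a x y z → a * x + z + a * y ≡ a * (x + y) + z
  collect = solve-∀

mult≡* : ∀ n y → n MonoidMult.× y ≡ n * y
mult≡* zero    y = refl
mult≡* (suc n) y = cong (y +_) (mult≡* n y)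

exp≡^ : ∀ y n → y SemiringExp.^ n ≡ y ^ n
exp≡^ y zero    = refl
exp≡^ y (suc n) = cong (y *_) (exp≡^ y n)

^-distribʳ-* : ∀ a b n → (a * b) ^ n ≡ a ^ n * b ^ n
^-distribʳ-* a b n =
  trans (sym (exp≡^ (a * b) n)) (trans (CommutativeExp.^-distrib-* a b n) (cong₂ _*_ (exp≡^ a n) (exp≡^ b n)))

binomial-theorem : ∀ x m → suc x ^ m ≡ Σ< (suc m) (λ k → (m C k) * x ^ k)
binomial-theorem x m = begin
  suc x ^ m                          ≡⟨ cong (_^ m) (+-comm 1 x) ⟩
  (x + 1) ^ m                        ≡⟨ sym (exp≡^ (x + 1) m) ⟩
  (x + 1) SemiringExp.^ m            ≡⟨ Binomial.theorem m x 1 ⟩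
  Binomial.binomialExpansion x 1 m   ≡⟨ sum-cong-≗ {suc m} (λ k → term (toℕ k)) ⟩
  sum {suc m} (λ k → (m C toℕ k) * x ^ toℕ k) ≡⟨ sum≡Σ< (suc m) (λ k → (m C k) * x ^ k) ⟩
  Σ< (suc m) (λ k → (m C k) * x ^ k) ∎
  where
  open ≡-Reasoning
  term : ∀ k → (m C k) MonoidMult.× (x SemiringExp.^ k * 1 SemiringExp.^ (m ∸ k)) ≡ (m C k) * x ^ k
  term k rewrite mult≡* (m C k) (x SemiringExp.^ k * 1 SemiringExp.^ (m ∸ k))
               | exp≡^ x k | exp≡^ 1 (m ∸ k) | ^-zeroˡ (m ∸ k) | *-identityʳ (x ^ k) = refl

[n+1]Cn≡n+1 : ∀ n → suc n C n ≡ suc n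
[n+1]Cn≡n+1 n = begin
  suc n C n             ≡⟨ nCk≡nC[n∸k] (n≤1+n n) ⟩
  suc n C (suc n ∸ n)   ≡⟨ cong (suc n C_) (trans (+-∸-assoc 1 (≤-refl {n})) (cong suc (n∸n≡0 n))) ⟩
  suc n C 1             ≡⟨ nC1≡n (suc n) ⟩
  suc n                 ∎
  where open ≡-Reasoning

power-sum-recursion : ∀ N m → suc N ^ suc m ≡ 1 + Σ< (suc m) (λ k → (suc m C k) * S k N)
power-sum-recursion zero    m = begin
  1 ^ suc m                                  ≡⟨ ^-zeroˡ (suc m) ⟩
  1                                          ≡⟨ cong (1 +_) (Σ<-*ˡ (suc m) 0 (λ k → k)) ⟨
  1 + Σ< (suc m) (λ _ → 0)                   ≡⟨ cong (1 +_) (Σ<-cong (suc m) (λ k _ → *-zeroʳ (suc m C k))) ⟨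
  1 + Σ< (suc m) (λ k → (suc m C k) * S k 0) ∎
  where open ≡-Reasoning
power-sum-recursion (suc N) m = begin
  suc (suc N) ^ suc m
    ≡⟨ binomial-theorem (suc N) (suc m) ⟩
  Σ< (suc m) powers + (suc m C suc m) * suc N ^ suc m
    ≡⟨ cong (λ c → Σ< (suc m) powers + c * suc N ^ suc m) (nCn≡1 (suc m)) ⟩
  Σ< (suc m) powers + 1 * suc N ^ suc m
    ≡⟨ cong (Σ< (suc m) powers +_) (trans (*-identityˡ _) (power-sum-recursion N m)) ⟩
  Σ< (suc m) powers + (1 + Σ< (suc m) sums)
    ≡⟨ regroup (Σ< (suc m) powers) (Σ< (suc m) sums) ⟩
  1 + (Σ< (suc m) sums + Σ< (suc m) powers)
    ≡⟨ cong (1 +_) (Σ<-+ (suc m) sums powers) ⟨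
  1 + Σ< (suc m) (λ k → sums k + powers k)
    ≡⟨ cong (1 +_) (Σ<-cong (suc m) (λ k _ → *-distribˡ-+ (suc m C k) (S k N) (suc N ^ k))) ⟨
  1 + Σ< (suc m) (λ k → (suc m C k) * S k (suc N)) ∎
  where
  open ≡-Reasoning
  powers sums : ℕ → ℕ
  powers k = (suc m C k) * suc N ^ k
  sums   k = (suc m C k) * S k N
  regroup : ∀ a b → a + (1 + b) ≡ 1 + (b + a)
  regroup = solve-∀

-- Congruence modulo m, stated without subtraction: x ≡ y mod m iff
-- x + k·m = y + l·m for some k and l.
infix 4 _≡_mod_
record _≡_mod_ (x y m : ℕ) : Set where
  constructor congruent
  field
    k l     : ℕ
    balance : x + k * m ≡ y + l * m

module _ {m : ℕ} where

  ≡⇒mod : ∀ {x y} → x ≡ y → x ≡ y mod m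
  ≡⇒mod refl = congruent 0 0 refl

  mod-sym : ∀ {x y} → x ≡ y mod m → y ≡ x mod m
  mod-sym (congruent k l eq) = congruent l k (sym eq)

  mod-trans : ∀ {x y z} → x ≡ y mod m → y ≡ z mod m → x ≡ z mod m
  mod-trans {x} {y} {z} (congruent k l e₁) (congruent k′ l′ e₂) = congruent (k + k′) (l′ + l) (begin
    x + (k + k′) * m       ≡⟨ split x k k′ ⟩
    x + k * m + k′ * m     ≡⟨ cong (_+ k′ * m) e₁ ⟩
    y + l * m + k′ * m     ≡⟨ +-comm-tail y (l * m) (k′ * m) ⟩
    y + k′ * m + l * m     ≡⟨ cong (_+ l * m) e₂ ⟩
    z + l′ * m + l * m     ≡⟨ sym (split z l′ l) ⟩
    z + (l′ + l) * m       ∎)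
    where
    open ≡-Reasoning
    split : ∀ a b c → a + (b + c) * m ≡ a + b * m + c * m
    split a b c = trans (cong (a +_) (*-distribʳ-+ m b c)) (sym (+-assoc a (b * m) (c * m)))
    +-comm-tail : ∀ a b c → a + b + c ≡ a + c + b
    +-comm-tail = solve-∀

  mod-isEquivalence : IsEquivalence (λ x y → x ≡ y mod m)
  mod-isEquivalence = record { refl = ≡⇒mod refl ; sym = mod-sym ; trans = mod-trans }

  mod-+ : ∀ {x y u v} → x ≡ y mod m → u ≡ v mod m → x + u ≡ y + v mod m
  mod-+ {x} {y} {u} {v} (congruent k l e₁) (congruent k′ l′ e₂) = congruent (k + k′) (l + l′) (begin
    x + u + (k + k′) * m       ≡⟨ regroup x u k k′ m ⟩
    (x + k * m) + (u + k′ * m) ≡⟨ cong₂ _+_ e₁ e₂ ⟩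
    (y + l * m) + (v + l′ * m) ≡⟨ sym (regroup y v l l′ m) ⟩
    y + v + (l + l′) * m       ∎)
    where
    open ≡-Reasoning
    regroup : ∀ a b c d m → a + b + (c + d) * m ≡ (a + c * m) + (b + d * m)
    regroup = solve-∀

  mod-* : ∀ {x y u v} → x ≡ y mod m → u ≡ v mod m → x * u ≡ y * v mod m
  mod-* {x} {y} {u} {v} (congruent k l e₁) (congruent k′ l′ e₂) =
    congruent (k * u + x * k′ + k * k′ * m) (l * v + y * l′ + l * l′ * m) (begin
      x * u + (k * u + x * k′ + k * k′ * m) * m ≡⟨ expand x u k k′ m ⟩
      (x + k * m) * (u + k′ * m)                ≡⟨ cong₂ _*_ e₁ e₂ ⟩
      (y + l * m) * (v + l′ * m)                ≡⟨ sym (expand y v l l′ m) ⟩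
      y * v + (l * v + y * l′ + l * l′ * m) * m ∎)
    where
    open ≡-Reasoning
    expand : ∀ a b c d m → a * b + (c * b + a * d + c * d * m) * m ≡ (a + c * m) * (b + d * m)
    expand = solve-∀

  mod-*ˡ : ∀ a {u v} → u ≡ v mod m → a * u ≡ a * v mod m
  mod-*ˡ a = mod-* (≡⇒mod {x = a} refl)

  mod-*ʳ : ∀ a {u v} → u ≡ v mod m → u * a ≡ v * a mod m
  mod-*ʳ a u≡v = mod-* u≡v (≡⇒mod {x = a} refl)

  mod-^ : ∀ {x y} n → x ≡ y mod m → x ^ n ≡ y ^ n mod m
  mod-^ zero    x≡y = ≡⇒mod refl
  mod-^ (suc n) x≡y = mod-* x≡y (mod-^ n x≡y)

  mod-Σ< : ∀ n {f g : ℕ → ℕ} → (∀ k → k < n → f k ≡ g k mod m) → Σ< n f ≡ Σ< n g mod m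
  mod-Σ< zero    f≡g = ≡⇒mod refl
  mod-Σ< (suc n) f≡g = mod-+ (mod-Σ< n (λ k k<n → f≡g k (m<n⇒m<1+n k<n))) (f≡g n ≤-refl)

  ∣⇒≡0 : ∀ {x} → m ∣ x → x ≡ 0 mod m
  ∣⇒≡0 (divides t eq) = congruent 0 t (trans (+-identityʳ _) eq)

  +-multiple : ∀ x t → x + t * m ≡ x mod m
  +-multiple x t = congruent 0 t (+-identityʳ (x + t * m))

  ≡0⇒∣ : ∀ {x} → x ≡ 0 mod m → m ∣ x
  ≡0⇒∣ {x} (congruent k l eq) =
    ∣m+n∣m⇒∣n (subst (m ∣_) (trans (sym eq) (+-comm x (k * m))) (n∣m*n l)) (n∣m*n k)

  mod-cancelˡ : ∀ a {x y} → a + x ≡ a + y mod m → x ≡ y mod m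
  mod-cancelˡ a {x} {y} (congruent k l eq) =
    congruent k l (+-cancelˡ-≡ a _ _ (trans (sym (+-assoc a x (k * m))) (trans eq (+-assoc a y (l * m)))))

  mod-∣ : ∀ {d x y} → d ∣ m → x ≡ y mod m → x ≡ y mod d
  mod-∣ {d} {x} {y} (divides t m≡td) (congruent k l eq) = congruent (k * t) (l * t) (begin
    x + k * t * d   ≡⟨ cong (x +_) (trans (*-assoc k t d) (cong (k *_) (sym m≡td))) ⟩
    x + k * m       ≡⟨ eq ⟩
    y + l * m       ≡⟨ cong (y +_) (trans (cong (l *_) m≡td) (sym (*-assoc l t d))) ⟩
    y + l * t * d   ∎)
    where open ≡-Reasoning

mod-setoid : ℕ → Setoid 0ℓ 0ℓ
mod-setoid m = record
  { Carrier = ℕ ; _≈_ = λ x y → x ≡ y mod m ; isEquivalence = mod-isEquivalence }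

module ModReasoning (m : ℕ) = SetoidReasoning (mod-setoid m)

module _ {m : ℕ} .{{_ : NonZero m}} where

  mod-% : ∀ x → x ≡ x % m mod m
  mod-% x = congruent 0 (x / m) (trans (+-identityʳ x) (m≡m%n+[m/n]*n x m))

  mod⇒% : ∀ {x y} → x ≡ y mod m → x % m ≡ y % m
  mod⇒% {x} {y} (congruent k l eq) =
    trans (sym ([m+kn]%n≡m%n x k m)) (trans (cong (_% m) eq) ([m+kn]%n≡m%n y l m))

  %⇒mod : ∀ {x y} → x % m ≡ y % m → x ≡ y mod m
  %⇒mod {x} {y} eq = mod-trans (mod-% x) (mod-trans (≡⇒mod eq) (mod-sym (mod-% y)))

  infix 4 _≡?_mod
  _≡?_mod : ∀ x y → Dec (x ≡ y mod m)
  x ≡? y mod = map′ %⇒mod mod⇒% (x % m ≟ y % m)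

coprime-^ : ∀ {q c} → Prime q → ¬ q ∣ c → ∀ k → Coprime (q ^ k) c
coprime-^ q-prime q∤c zero    (d∣1 , _)      = ∣1⇒≡1 d∣1
coprime-^ {q} q-prime q∤c (suc k) {d} (d∣qqᵏ , d∣c) =
  coprime-^ q-prime q∤c k (coprime-divisor d⊥q d∣qqᵏ , d∣c)
  where
  d⊥q : Coprime d q
  d⊥q (e∣d , e∣q) with prime⇒irreducible q-prime e∣q
  ... | inj₁ e≡1    = e≡1
  ... | inj₂ refl   = contradiction (∣-trans e∣d d∣c) q∤c

prime-cancel : ∀ {q a b} → Prime q → ¬ q ∣ a → q ∣ a * b → q ∣ b
prime-cancel q-prime q∤a q∣ab =
  [ (λ q∣a → contradiction q∣a q∤a) , (λ q∣b → q∣b) ]′ (euclidsLemma _ _ q-prime q∣ab)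

∤-small : ∀ {d c} → 1 ≤ c → c < d → ¬ d ∣ c
∤-small 1≤c c<d d∣c = <⇒≱ c<d (∣⇒≤ {{>-nonZero 1≤c}} d∣c)

n<m^n : ∀ {m} → 1 < m → ∀ n → n < m ^ n
n<m^n 1<m zero    = s≤s z≤n
n<m^n {m} 1<m (suc n) = begin
  suc (suc n)     ≡⟨ +-comm 1 (suc n) ⟩
  suc n + 1       ≤⟨ +-mono-≤ (n<m^n 1<m n) (m^n>0 m {{>-nonZero (<-trans z<s 1<m)}} n) ⟩
  m ^ n + m ^ n   ≡⟨ cong (m ^ n +_) (sym (+-identityʳ (m ^ n))) ⟩
  2 * m ^ n       ≤⟨ *-monoˡ-≤ (m ^ n) 1<m ⟩
  m * m ^ n       ∎
  where open ≤-Reasoning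

^-monoʳ-∣ : ∀ m {a b} → a ≤ b → m ^ a ∣ m ^ b
^-monoʳ-∣ m {a} {b} a≤b =
  divides (m ^ (b ∸ a)) (trans (cong (m ^_) (sym (m+[n∸m]≡n a≤b))) (trans (^-distribˡ-+-* m a (b ∸ a)) (*-comm (m ^ a) (m ^ (b ∸ a)))))

inverse : ∀ {c} N .{{_ : NonZero N}} → Coprime c N → ∃[ d ] c * d ≡ 1 mod N
inverse {c} (suc n) c⊥N with coprime-Bézout c⊥N
... | Bézout.+- x y eq = x , congruent 0 y (begin
  c * x + 0 * suc n     ≡⟨ +-identityʳ (c * x) ⟩
  c * x                 ≡⟨ *-comm c x ⟩
  x * c                 ≡⟨ sym eq ⟩
  1 + y * suc n         ∎)
  where open ≡-Reasoning
... | Bézout.-+ x y eq = x * n , congruent y (x * c) (begin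
  c * (x * n) + y * suc n   ≡⟨ cong (c * (x * n) +_) (sym eq) ⟩
  c * (x * n) + (1 + x * c) ≡⟨ regroup c x n ⟩
  1 + x * c * suc n         ∎)
  where
  open ≡-Reasoning
  regroup : ∀ c x n → c * (x * n) + (1 + x * c) ≡ 1 + x * c * suc n
  regroup = solve-∀

module ResidueMultiplication (N : ℕ) .{{_ : NonZero N}} where

  times : ℕ → Fin N → Fin N
  times a r = fromℕ< (m%n<n (a * toℕ r) N)

  times-compose : ∀ a b r → a * toℕ (times b r) ≡ a * b * toℕ r mod N
  times-compose a b r = begin
    a * toℕ (times b r)     ≡⟨ cong (a *_) (toℕ-fromℕ< _) ⟩
    a * ((b * toℕ r) % N)   ≈⟨ mod-*ˡ a (mod-sym (mod-% (b * toℕ r))) ⟩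
    a * (b * toℕ r)         ≡⟨ sym (*-assoc a b (toℕ r)) ⟩
    a * b * toℕ r           ∎
    where open ModReasoning N

  times-inverse : ∀ a b → a * b ≡ 1 mod N → ∀ r → times a (times b r) ≡ r
  times-inverse a b ab≡1 r = toℕ-injective (begin
    toℕ (times a (times b r))     ≡⟨ toℕ-fromℕ< _ ⟩
    (a * toℕ (times b r)) % N     ≡⟨ mod⇒% (mod-trans (times-compose a b r) ab·r≡r) ⟩
    toℕ r % N                     ≡⟨ m<n⇒m%n≡m (toℕ<n r) ⟩
    toℕ r                         ∎)
    where
    open ≡-Reasoning
    ab·r≡r : a * b * toℕ r ≡ toℕ r mod N
    ab·r≡r = mod-trans (mod-*ʳ (toℕ r) ab≡1) (≡⇒mod (*-identityˡ (toℕ r)))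

  Σ<-permute : ∀ {c d} → c * d ≡ 1 mod N →
               (g : ℕ → ℕ) → Σ< N (λ r → g ((c * r) % N)) ≡ Σ< N g
  Σ<-permute {c} {d} cd≡1 g = begin
    Σ< N (λ r → g ((c * r) % N))         ≡⟨ sym (sum≡Σ< N (λ r → g ((c * r) % N))) ⟩
    sum {N} (λ r → g ((c * toℕ r) % N))   ≡⟨ sum-cong-≗ {N} {λ r → g ((c * toℕ r) % N)} {λ r → g (toℕ (times c r))}
                                            (λ r → cong g (sym (toℕ-fromℕ< _))) ⟩
    sum {N} (λ r → g (toℕ (times c r)))   ≡⟨ sym (sum-permute (λ r → g (toℕ r)) π) ⟩
    sum {N} (λ r → g (toℕ r))             ≡⟨ sum≡Σ< N g ⟩
    Σ< N g                                ∎
    where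
    open ≡-Reasoning
    π : Permutation N N
    π = permutation (times c) (times d) (times-inverse c d cd≡1)
                    (times-inverse d c (subst (λ x → x ≡ 1 mod N) (*-comm c d) cd≡1))

open ResidueMultiplication using (Σ<-permute)

binomial-mod-square : ∀ a b n → (a + b) ^ suc n ≡ a ^ suc n + suc n * a ^ n * b mod b * b
binomial-mod-square a b zero    = ≡⇒mod (linear a b)
  where
  linear : ∀ a b → (a + b) * 1 ≡ a * 1 + 1 * 1 * b
  linear = solve-∀
binomial-mod-square a b (suc n) = begin
  (a + b) * (a + b) ^ suc n
    ≈⟨ mod-*ˡ (a + b) (binomial-mod-square a b n) ⟩
  (a + b) * (a ^ suc n + suc n * a ^ n * b)
    ≡⟨ expand a b (a ^ n) n ⟩
  a ^ suc (suc n) + suc (suc n) * a ^ suc n * b + suc n * a ^ n * (b * b)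
    ≈⟨ +-multiple _ (suc n * a ^ n) ⟩
  a ^ suc (suc n) + suc (suc n) * a ^ suc n * b ∎
  where
  open ModReasoning (b * b)
  expand : ∀ a b x n → (a + b) * (a * x + suc n * x * b)
                       ≡ a * (a * x) + suc (suc n) * (a * x) * b + suc n * x * (b * b)
  expand = solve-∀

^-lift : ∀ p {m x y} → suc p ∣ m → x ≡ y mod m → x ^ suc p ≡ y ^ suc p mod suc p * m
^-lift p {m} {x} {y} (divides s m≡sq) (congruent k l eq) = begin
  x ^ q               ≈⟨ mod-sym (shift x k) ⟩
  (x + k * m) ^ q     ≡⟨ cong (_^ q) eq ⟩
  (y + l * m) ^ q     ≈⟨ shift y l ⟩
  y ^ q               ∎
  where
  open ModReasoning (suc p * m)
  q : ℕ
  q = suc p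
  qm∣[tm]² : ∀ t → q * m ∣ t * m * (t * m)
  qm∣[tm]² t = divides (t * t * s) (trans (cong (λ u → t * m * (t * u)) m≡sq) (regroup t m s q))
    where
    regroup : ∀ t m s q → t * m * (t * (s * q)) ≡ t * t * s * (q * m)
    regroup = solve-∀
  shift : ∀ z t → (z + t * m) ^ q ≡ z ^ q mod q * m
  shift z t = begin
    (z + t * m) ^ q                   ≈⟨ mod-∣ (qm∣[tm]² t) (binomial-mod-square z (t * m) p) ⟩
    z ^ q + q * z ^ p * (t * m)       ≡⟨ cong (z ^ q +_) (regroup q (z ^ p) t m) ⟩
    z ^ q + z ^ p * t * (q * m)       ≈⟨ +-multiple (z ^ q) (z ^ p * t) ⟩
    z ^ q                             ∎
    where
    regroup : ∀ q a t m → q * a * (t * m) ≡ a * t * (q * m)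
    regroup = solve-∀

^-lift-∣ : ∀ p i k n {x y} → suc p ^ i ∣ n →
           x ≡ y mod suc p ^ suc k → x ^ n ≡ y ^ n mod suc p ^ (i + suc k)
^-lift-∣ p i k n {x} {y} (divides t n≡tqⁱ) x≡y = begin
  x ^ n             ≡⟨ power x ⟩
  (x ^ q ^ i) ^ t   ≈⟨ mod-^ t (lift-^ i) ⟩
  (y ^ q ^ i) ^ t   ≡⟨ sym (power y) ⟩
  y ^ n             ∎
  where
  open ModReasoning (suc p ^ (i + suc k))
  q : ℕ
  q = suc p
  power : ∀ z → z ^ n ≡ (z ^ q ^ i) ^ t
  power z = trans (cong (z ^_) (trans n≡tqⁱ (*-comm t (q ^ i)))) (sym (^-*-assoc z (q ^ i) t))
  lift-^ : ∀ a → x ^ q ^ a ≡ y ^ q ^ a mod q ^ (a + suc k)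
  lift-^ zero    = mod-*ʳ 1 x≡y
  lift-^ (suc a) = subst₂ (λ u v → u ≡ v mod q ^ (suc a + suc k)) (power-q x) (power-q y)
                          (^-lift p q∣qᵃ⁺ᵏ⁺¹ (lift-^ a))
    where
    q∣qᵃ⁺ᵏ⁺¹ : q ∣ q ^ (a + suc k)
    q∣qᵃ⁺ᵏ⁺¹ = subst (λ e → q ∣ q ^ e) (sym (+-suc a k)) (m∣m*n (q ^ (a + k)))
    power-q : ∀ z → (z ^ q ^ a) ^ q ≡ z ^ q ^ suc a
    power-q z = trans (^-*-assoc z (q ^ a) q) (cong (z ^_) (*-comm (q ^ a) q))

-- If u·T ≡ T modulo a power of a prime q and u ≢ 1 (mod q), then that prime
-- power divides T: write u = e + 1 with q ∤ e, so q^K ∣ e·T forces q^K ∣ T.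
fixed-by-nonunit⇒∣ : ∀ {q u T} K → Prime q → ¬ (u ≡ 1 mod q) → u * T ≡ T mod q ^ K → q ^ K ∣ T
fixed-by-nonunit⇒∣ {u = zero}      K q-prime u≢1 0≡T = ≡0⇒∣ (mod-sym 0≡T)
fixed-by-nonunit⇒∣ {q} {suc e} {T} K q-prime u≢1 uT≡T =
  coprime-divisor (coprime-^ q-prime q∤e K) (≡0⇒∣ eT≡0)
  where
  q∤e : ¬ q ∣ e
  q∤e q∣e = u≢1 (mod-+ (≡⇒mod {x = 1} refl) (∣⇒≡0 q∣e))
  eT≡0 : e * T ≡ 0 mod q ^ K
  eT≡0 = mod-cancelˡ T (mod-trans uT≡T (≡⇒mod (sym (+-identityʳ T))))

module PrimePowerSums {p : ℕ} (q-prime : Prime (suc p)) where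

  q : ℕ
  q = suc p

  1<q : 1 < q
  1<q = nonTrivial⇒n>1 q {{prime⇒nonTrivial q-prime}}

  1≤p : 1 ≤ p
  1≤p = s≤s⁻¹ 1<q

  q∣qCk : ∀ k → k < p → q ∣ q C suc k
  q∣qCk k k<p = prime-cancel q-prime (∤-small (s≤s z≤n) (s≤s k<p)) (subst (q ∣_) (sym (absorption p k)) (m∣m*n (p C k)))

  fermat : ∀ x → x ^ q ≡ x mod q
  fermat zero    = ≡⇒mod refl
  fermat (suc x) = begin
    suc x ^ q                                  ≡⟨ binomial-theorem x q ⟩
    Σ< q term + term q                         ≡⟨ cong (_+ term q) (Σ<-head p term) ⟩
    term 0 + Σ< p (λ k → term (suc k)) + term q ≈⟨ mod-+ (mod-+ (≡⇒mod {x = term 0} refl) (∣⇒≡0 inner)) (≡⇒mod {x = term q} refl) ⟩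
    1 + 0 + term q                             ≡⟨ cong (1 +_) (trans (cong (_* x ^ q) (nCn≡1 q)) (*-identityˡ (x ^ q))) ⟩
    1 + x ^ q                                  ≈⟨ mod-+ (≡⇒mod {x = 1} refl) (fermat x) ⟩
    suc x                                      ∎
    where
    open ModReasoning q
    term : ℕ → ℕ
    term k = (q C k) * x ^ k
    inner : q ∣ Σ< p (λ k → term (suc k))
    inner = Σ<-∣ p (λ k → term (suc k)) (λ k k<p → ∣m⇒∣m*n (x ^ suc k) (q∣qCk k k<p))

  ^-periodic : ∀ x n → x ^ (suc n + p) ≡ x ^ suc n mod q
  ^-periodic x n = begin
    x ^ (suc n + p)   ≡⟨ cong (x ^_) (sym (+-suc n p)) ⟩
    x ^ (n + q)       ≡⟨ ^-distribˡ-+-* x n q ⟩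
    x ^ n * x ^ q     ≈⟨ mod-*ˡ (x ^ n) (fermat x) ⟩
    x ^ n * x         ≡⟨ *-comm (x ^ n) x ⟩
    x ^ suc n         ∎
    where open ModReasoning q

  S-periodic : ∀ n N → S (suc n + p) N ≡ S (suc n) N mod q
  S-periodic n zero    = ≡⇒mod refl
  S-periodic n (suc N) = mod-+ (S-periodic n N) (^-periodic (suc N) n)

  -- Below p, the power sum recursion, read modulo q, says
  -- 0 ≡ q^(n+1) ≡ (n+1)·S_n(p) once q divides S_k(p) for all 1 ≤ k < n.
  leading-term≡0 : ∀ m → (∀ k → 1 ≤ k → k < suc m → q ∣ S k p) → 0 ≡ suc (suc m) * S (suc m) p mod q
  leading-term≡0 m smaller = begin
    0                                                  ≈⟨ mod-sym (∣⇒≡0 (m∣m*n (q ^ n))) ⟩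
    q ^ suc n                                          ≡⟨ power-sum-recursion p n ⟩
    1 + (Σ< n term + term n)                           ≡⟨ cong (λ s → 1 + (s + term n)) (Σ<-head m term) ⟩
    1 + (term 0 + Σ< m (λ k → term (suc k)) + term n)
      ≡⟨ cong₂ (λ a b → 1 + (a + Σ< m (λ k → term (suc k)) + b))
               (trans (*-identityˡ (S 0 p)) (S₀ p)) (cong (_* S n p) ([n+1]Cn≡n+1 n)) ⟩
    q + Σ< m (λ k → term (suc k)) + suc n * S n p
      ≈⟨ mod-+ (mod-+ (∣⇒≡0 (∣-refl {q})) (∣⇒≡0 inner)) (≡⇒mod {x = suc n * S n p} refl) ⟩
    suc n * S n p                                      ∎
    where
    open ModReasoning q
    n : ℕ
    n = suc m
    term : ℕ → ℕ
    term k = (suc n C k) * S k p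
    inner : q ∣ Σ< m (λ k → term (suc k))
    inner = Σ<-∣ m (λ k → term (suc k))
                 (λ k k<m → ∣n⇒∣m*n (suc n C suc k) (smaller (suc k) (s≤s z≤n) (s≤s k<m)))

  -- Hence q ∣ S_n(p) for 1 ≤ n < p, since q ∤ n + 1.
  S-vanishes-below : ∀ m → suc m < p → (∀ k → 1 ≤ k → k < suc m → q ∣ S k p) → q ∣ S (suc m) p
  S-vanishes-below m n<p smaller =
    prime-cancel q-prime (∤-small (s≤s z≤n) (s≤s n<p)) (≡0⇒∣ (mod-sym (leading-term≡0 m smaller)))

  -- q ∣ S_n(p) whenever 1 ≤ n and p ∤ n, by strong induction on n: exponents
  -- below p are handled by S-vanishes-below, larger ones are reduced by p.
  S-vanishes : ∀ n → 1 ≤ n → ¬ p ∣ n → q ∣ S n p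
  S-vanishes = <-rec (λ n → 1 ≤ n → ¬ p ∣ n → q ∣ S n p) step
    where
    step : ∀ n → (∀ {k} → k < n → 1 ≤ k → ¬ p ∣ k → q ∣ S k p) → 1 ≤ n → ¬ p ∣ n → q ∣ S n p
    step (suc m) smaller _ p∤n with suc m <? p
    ... | yes n<p = S-vanishes-below m n<p
                      (λ k 1≤k k<n → smaller k<n 1≤k (∤-small 1≤k (<-trans k<n n<p)))
    ... | no  n≮p = reduce (suc m ∸ p) (m∸n+n≡m (≮⇒≥ n≮p))
      where
      reduce : ∀ r → r + p ≡ suc m → q ∣ S (suc m) p
      reduce zero    p≡n = contradiction (subst (p ∣_) p≡n ∣-refl) p∤n
      reduce (suc r) eq  = subst (λ n → q ∣ S n p) eq
        (≡0⇒∣ (mod-trans (S-periodic r p) (∣⇒≡0 (smaller r+1<n (s≤s z≤n) p∤r+1))))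
        where
        r+1<n : suc r < suc m
        r+1<n = subst (suc r <_) eq (m<m+n (suc r) 1≤p)
        p∤r+1 : ¬ p ∣ suc r
        p∤r+1 p∣r+1 = p∤n (subst (p ∣_) eq (∣m∣n⇒∣m+n p∣r+1 ∣-refl))

  -- If p ∤ n, some 1 ≤ c ≤ p has c^n ≢ 1 (mod q): otherwise S_n(p) ≡ p (mod q),
  -- whereas q ∣ S_n(p) and q ∤ p.
  nonresidue : ∀ n → 1 ≤ n → ¬ p ∣ n → ∃[ c ] 1 ≤ c × c ≤ p × ¬ (c ^ n ≡ 1 mod q)
  nonresidue n 1≤n p∤n with ¬∀⟶∃¬ p (λ i → suc (toℕ i) ^ n ≡ 1 mod q)
                                    (λ i → suc (toℕ i) ^ n ≡? 1 mod) ¬all-residues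
    where
    ¬all-residues : ¬ (∀ i → suc (toℕ i) ^ n ≡ 1 mod q)
    ¬all-residues all-residues = ∤-small 1≤p (n<1+n p)
      (≡0⇒∣ (mod-trans (mod-sym (S≡N p ≤-refl)) (∣⇒≡0 (S-vanishes n 1≤n p∤n))))
      where
      S≡N : ∀ N → N ≤ p → S n N ≡ N mod q
      S≡N zero    _   = ≡⇒mod refl
      S≡N (suc N) N<p = mod-trans
        (mod-+ (S≡N N (<⇒≤ N<p))
               (subst (λ c → suc c ^ n ≡ 1 mod q) (toℕ-fromℕ< N<p) (all-residues (fromℕ< N<p))))
        (≡⇒mod (+-comm N 1))
  ... | i , cⁿ≢1 = suc (toℕ i) , s≤s z≤n , toℕ<n i , cⁿ≢1

  -- Multiplying every r < N = q^(j+1) by a unit c modulo N permutes the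
  -- residues, and rⁿ modulo q^(i+j+1) depends only on r modulo N because
  -- q^i ∣ n; hence T = Σ_{r<N} rⁿ satisfies cⁿ·T ≡ T modulo q^(i+j+1).
  Σ-powers-invariant : ∀ i j n {c d} → q ^ i ∣ n → c * d ≡ 1 mod q ^ suc j →
    c ^ n * Σ< (q ^ suc j) (λ r → r ^ n) ≡ Σ< (q ^ suc j) (λ r → r ^ n) mod q ^ (i + suc j)
  Σ-powers-invariant i j n {c} qⁱ∣n cd≡1 = begin
    c ^ n * Σ< N (λ r → r ^ n)        ≡⟨ Σ<-*ˡ N (c ^ n) (λ r → r ^ n) ⟨
    Σ< N (λ r → c ^ n * r ^ n)        ≡⟨ Σ<-cong N (λ r _ → ^-distribʳ-* c r n) ⟨
    Σ< N (λ r → (c * r) ^ n)          ≈⟨ mod-Σ< N (λ r _ → ^-lift-∣ p i j n qⁱ∣n (mod-% (c * r))) ⟩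
    Σ< N (λ r → ((c * r) % N) ^ n)    ≡⟨ Σ<-permute N {c = c} cd≡1 (_^ n) ⟩
    Σ< N (λ r → r ^ n)                ∎
    where
    open ModReasoning (q ^ (i + suc j))
    N : ℕ
    N = q ^ suc j
    instance
      N≢0 : NonZero N
      N≢0 = m^n≢0 q (suc j)

  -- Hence, choosing c with cⁿ ≢ 1 (mod q), q^(i+j+1) divides T.
  Σ-powers-divisible : ∀ i j n → 1 ≤ n → ¬ p ∣ n → q ^ i ∣ n →
                       q ^ (i + suc j) ∣ Σ< (q ^ suc j) (λ r → r ^ n)
  Σ-powers-divisible i j n 1≤n p∤n qⁱ∣n =
    let (c , 1≤c , c≤p , cⁿ≢1) = nonresidue n 1≤n p∤n
        c⊥N : Coprime c (q ^ suc j)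
        c⊥N = Coprime.sym (coprime-^ q-prime (∤-small 1≤c (s≤s c≤p)) (suc j))
        (d , cd≡1) = inverse (q ^ suc j) {{m^n≢0 q (suc j)}} c⊥N
    in fixed-by-nonunit⇒∣ (i + suc j) q-prime cⁿ≢1 (Σ-powers-invariant i j n qⁱ∣n cd≡1)

  -- The theorem for q = p + 1, exponent n + 1 and modulus q^(j+1):
  -- S_n(N) = Σ_{r<N} rⁿ + Nⁿ, and both summands are divisible by q^(i+j+1),
  -- the second one because i < n.
  S-divisible : ∀ i j n → ¬ p ∣ suc n → q ^ i ∣ suc n → q ^ (i + suc j) ∣ S (suc n) (q ^ suc j)
  S-divisible i j n p∤n qⁱ∣n = subst (q ^ (i + suc j) ∣_) (sym (S≡Σ<+last n (q ^ suc j)))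
    (∣m∣n⇒∣m+n (Σ-powers-divisible i j (suc n) (s≤s z≤n) p∤n qⁱ∣n) qⁱ⁺ʲ⁺¹∣Nⁿ)
    where
    i<n : i < suc n
    i<n = <-≤-trans (n<m^n 1<q i) (∣⇒≤ qⁱ∣n)
    exponent-bound : i + suc j ≤ suc j * suc n
    exponent-bound = begin
      i + suc j          ≡⟨ +-suc i j ⟩
      suc i + j          ≤⟨ +-mono-≤ i<n (m≤m*n j (suc n)) ⟩
      suc j * suc n      ∎
      where open ≤-Reasoning
    qⁱ⁺ʲ⁺¹∣Nⁿ : q ^ (i + suc j) ∣ (q ^ suc j) ^ suc n
    qⁱ⁺ʲ⁺¹∣Nⁿ = subst (q ^ (i + suc j) ∣_) (sym (^-*-assoc q (suc j) (suc n))) (^-monoʳ-∣ q exponent-bound)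

-- Theorem 7.  For a prime q with (q − 1) ∤ n and q^i ∣ n (j, n ≥ 1),
-- q^(i+j) divides S_n(q^j).
theorem7 : (i j n q : ℕ) → j ≥ 1 → n ≥ 1 → Prime q → ¬ (2 ∣ q)
    → ¬ ((q ∸ 1) ∣ n) → (q ^ i) ∣ n → (q ^ (i + j)) ∣ S n (q ^ j)
theorem7 i (suc j) (suc n) (suc p) _ _ q-prime _ p∤n qⁱ∣n = PrimePowerSums.S-divisible q-prime i j n p∤n qⁱ∣n
theorem7 _ _ _ zero _ _ q-prime _ _ _ = contradiction refl (≢-nonZero⁻¹ 0 {{prime⇒nonZero q-prime}})
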